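{- Let $P$ be a finite poset with $|P|\ge 2$, let $\mathcal{F}$ be a family of posets, let $k$ be a positive integer, and let $n=|P|^k=|P^k|$. Then \[ \operatorname{ex}^{*}(|P|^k,\mathcal{F})\;\le\;\operatorname{ex}^{*}(P^k,\mathcal{F})\;\le\; n^{\log_{|P|}(\operatorname{ex}^{*}(P,\mathcal{F}))}, \] where the right-hand side is to be read as $\left(\operatorname{ex}^{*}(P,\mathcal{F})\right)^k$ (which equals $n^{\log_{|P|}(\operatorname{ex}^{*}(P,\mathcal{F}))}$ whenever $\operatorname{ex}^{*}(P,\mathcal{F})\ge 1$).
   Context: For a poset $Q$ and a family of posets $\mathcal{F}$, a subposet of $Q$ is $\mathcal{F}$-free if it contains no member of $\mathcal{F}$ as an induced subposet. $\operatorname{ex}^{*}(Q,\mathcal{F})$ denotes the maximum size of an induced subposet of $Q$ that is $\mathcal{F}$-free. For a positive integer $n$, $\operatorname{ex}^{*}(n,\mathcal{F})$ denotes the minimum of $\operatorname{ex}^{*}(Q,\mathcal{F})$ over all $n$-element posets $Q$. For a poset $P$ and positive integer $k$, $P^k$ denotes the set of $k$-tuples of elements of $P$ with the lexicographic order: $(a_1,\dots,a_k)<(b_1,\dots,b_k)$ iff at the first index $i$ with $a_i\ne b_i$ one has $a_i<b_i$ in $P$. -}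

module Defs where

open import Data.Nat using (ℕ)
open import Data.Fin using (Fin)
open import Data.Vec using (Vec; []; _∷_)
open import Data.List using (List; length)
open import Data.List.Membership.Propositional using (_∈_)
open import Data.List.Relation.Unary.Unique.Propositional using (Unique)
open import Data.Product using (Σ; ∃; _×_; _,_)
open import Data.Sum using (_⊎_; inj₁; inj₂)
open import Data.Empty using (⊥; ⊥-elim)
open import Relation.Nullary using (¬_)
open import Relation.Binary.PropositionalEquality using (_≡_; refl) renaming (sym to ≡-sym)
open import Relation.Binary.Structures using (IsPartialOrder; IsPreorder)
open import Relation.Binary.PropositionalEquality.Properties using (isEquivalence)
open import Function.Bundles using (_↔_)
open import Function.Definitions using (Injective)

record Pos : Set₁ where
  field
    Carrier : Set
    _≤_     : Carrier → Carrier → Set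
    isPartialOrder : IsPartialOrder _≡_ _≤_
  open IsPartialOrder isPartialOrder public

open Pos using (Carrier; _≤_)

HasSize : Pos → ℕ → Set
HasSize Q n = Carrier Q ↔ Fin n

-- An induced subposet of Q is given by a duplicate-free list of its elements;
-- its size is the length of the list.
record SubPos (Q : Pos) : Set where
  field
    elems  : List (Carrier Q)
    unique : Unique elems

open SubPos

size : {Q : Pos} → SubPos Q → ℕ
size S = length (elems S)

Contains : {Q : Pos} → SubPos Q → Pos → Set
Contains {Q} S R =
  Σ (Carrier R → Carrier Q) λ f →
    Injective _≡_ _≡_ f ×
    (∀ x → f x ∈ elems S) ×
    (∀ x y → (_≤_ R x y → _≤_ Q (f x) (f y)) × (_≤_ Q (f x) (f y) → _≤_ R x y))

Family : Set₁
Family = Pos → Set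

Free : {Q : Pos} → Family → SubPos Q → Set₁
Free 𝓕 S = ∀ R → 𝓕 R → ¬ Contains S R

IsExStar : Pos → Family → ℕ → Set₁
IsExStar Q 𝓕 e =
  (Σ (SubPos Q) λ S → Free 𝓕 S × size S ≡ e) ×
  (∀ (S : SubPos Q) → Free 𝓕 S → Data.Nat._≤_ (size S) e)

IsExStarN : ℕ → Family → ℕ → Set₁
IsExStarN n 𝓕 e =
  (Σ Pos λ Q → HasSize Q n × IsExStar Q 𝓕 e) ×
  (∀ (Q : Pos) → HasSize Q n → ∀ e' → IsExStar Q 𝓕 e' → Data.Nat._≤_ e e')

module Lex (P : Pos) where
  open Pos P using (antisym; trans) renaming (Carrier to A; _≤_ to _≤P_)

  _<P_ : A → A → Set
  a <P b = a ≤P b × ¬ (a ≡ b)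

  data _<L_ : ∀ {k} → Vec A k → Vec A k → Set where
    here  : ∀ {k a b} {as bs : Vec A k} → a <P b → (a ∷ as) <L (b ∷ bs)
    there : ∀ {k a} {as bs : Vec A k} → as <L bs → (a ∷ as) <L (a ∷ bs)

  _≤L_ : ∀ {k} → Vec A k → Vec A k → Set
  x ≤L y = x ≡ y ⊎ x <L y

  <P-trans : ∀ {a b c} → a <P b → b <P c → a <P c
  <P-trans (ab , a≢b) (bc , b≢c) =
    trans ab bc , λ { refl → a≢b (antisym ab bc) }

  <L-trans : ∀ {k} {x y z : Vec A k} → x <L y → y <L z → x <L z
  <L-trans (here p)  (here q)  = here (<P-trans p q)
  <L-trans (here p)  (there q) = here p
  <L-trans (there p) (here q)  = here q
  <L-trans (there p) (there q) = there (<L-trans p q)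

  <L-asym : ∀ {k} {x y : Vec A k} → x <L y → y <L x → ⊥
  <L-asym (here (ab , a≢b)) (here (ba , _)) = a≢b (antisym ab ba)
  <L-asym (here (_ , a≢a))  (there _)       = a≢a refl
  <L-asym (there _)         (here (_ , a≢a)) = a≢a refl
  <L-asym (there p)         (there q)       = <L-asym p q

  ≤L-isPartialOrder : ∀ {k} → IsPartialOrder _≡_ (_≤L_ {k})
  ≤L-isPartialOrder = record
    { isPreorder = record
      { isEquivalence = isEquivalence
      ; reflexive = inj₁
      ; trans = λ { (inj₁ refl) q → q
                  ; p (inj₁ refl) → p
                  ; (inj₂ p) (inj₂ q) → inj₂ (<L-trans p q) } }
    ; antisym = λ { (inj₁ eq) _ → eq
                  ; (inj₂ p) (inj₁ eq) → ≡-sym eq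
                  ; (inj₂ p) (inj₂ q) → ⊥-elim (<L-asym p q) } }

_^ₚ_ : Pos → ℕ → Pos
P ^ₚ k = record
  { Carrier = Vec (Carrier P) k
  ; _≤_ = Lex._≤L_ P
  ; isPartialOrder = Lex.≤L-isPartialOrder P }

-- Let S be an 𝓕-free subposet of P^(k+1). Two elements of P^(k+1) with distinct first
-- coordinates compare exactly as those coordinates do, so choosing one element of S over
-- each first coordinate embeds the set of first coordinates of S into S: it is an 𝓕-free
-- subposet of P, of size at most ex*(P). Elements with a common first coordinate compare
-- as their tails, so each fibre of S is an 𝓕-free subposet of P^k. Hence
-- |S| ≤ ex*(P) · ex*(P^k), and ex*(P^k) ≤ ex*(P)^k by induction. The lower bound holds
-- because P^k is one of the posets with |P|^k elements over which ex*(|P|^k, 𝓕) minimises.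
module Submission where

open import Defs
open import Data.Nat using (ℕ; zero; suc; _≤_; _+_; _*_; _^_; z≤n; s≤s)
open import Data.Nat.Properties using (≤-trans; ≤-reflexive; +-suc; +-mono-≤; *-monoˡ-≤; module ≤-Reasoning)
open import Data.Product using (∃; _×_; _,_; proj₁; proj₂)
open import Data.Product.Function.NonDependent.Propositional using (_×-↔_)
open import Data.Sum using (inj₁; inj₂)
open import Data.Fin using (Fin; zero)
import Data.Fin as Fin
open import Data.Fin.Properties using (*↔×)
open import Data.Vec using (Vec; []; _∷_; head; tail)
open import Data.Vec.Properties using (∷-injectiveʳ; ≡-dec)
open import Data.List using (List; []; _∷_; length; map; filter; deduplicate)
open import Data.List.Properties using (length-map)
open import Data.List.Membership.Propositional using (_∈_)
open import Data.List.Membership.Propositional.Properties using (∈-map⁺; ∈-map⁻; ∈-filter⁻; ∈-deduplicate⁺; ∈-deduplicate⁻)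
open import Data.List.Relation.Unary.Any using (here; there)
open import Data.List.Relation.Unary.AllPairs using (_∷_)
open import Data.List.Relation.Unary.All using (_∷_)
open import Data.List.Relation.Unary.Unique.Propositional using (Unique)
import Data.List.Relation.Unary.Unique.Propositional.Properties as Unique
open import Data.List.Relation.Unary.Unique.DecPropositional.Properties using (deduplicate-!)
open import Data.List.Relation.Binary.Sublist.Propositional.Properties using (filter-⊆; length-mono-≤)
import Data.List.Relation.Binary.Sublist.Propositional.Properties as Sublist
open import Function using (_∘_)
open import Function.Bundles using (_↔_; mk↔ₛ′)
open import Function.Properties.Inverse using (↔-sym; ↔-trans; ↔⇒↣)
open import Relation.Nullary using (yes; no; ¬?; contradiction)
open import Relation.Nullary.Decidable using (via-injection)
open import Relation.Binary.Definitions using (DecidableEquality)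
open import Relation.Binary.PropositionalEquality using (_≡_; _≢_; refl; sym; trans; cong; subst; subst₂)

open Pos using (Carrier)
open SubPos

Vec-suc↔× : ∀ {A : Set} {k} → Vec A (suc k) ↔ (A × Vec A k)
Vec-suc↔× = mk↔ₛ′ (λ v → head v , tail v) (λ (a , v) → a ∷ v) (λ _ → refl) (λ { (_ ∷ _) → refl })

Vec↔Fin^ : ∀ {A : Set} {m} → A ↔ Fin m → ∀ k → Vec A k ↔ Fin (m ^ k)
Vec↔Fin^ A↔m zero    = mk↔ₛ′ (λ _ → zero) (λ _ → []) (λ { zero → refl }) (λ { [] → refl })
Vec↔Fin^ A↔m (suc k) = ↔-trans Vec-suc↔× (↔-trans (A↔m ×-↔ Vec↔Fin^ A↔m k) (↔-sym *↔×))

length≤1-Unique : ∀ {X : Set} → (∀ (x y : X) → x ≡ y) → ∀ {xs : List X} → Unique xs → length xs ≤ 1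
length≤1-Unique all≡ {[]}          _                = z≤n
length≤1-Unique all≡ {_ ∷ []}      _                = s≤s z≤n
length≤1-Unique all≡ {x ∷ y ∷ _}   ((x≢y ∷ _) ∷ _) = contradiction (all≡ x y) x≢y

module Fibres {X B : Set} (_≟_ : DecidableEquality B) (f : X → B) where

  fibre : B → List X → List X
  fibre b = filter (λ x → f x ≟ b)

  offFibre : B → List X → List X
  offFibre b = filter (λ x → ¬? (f x ≟ b))

  length-fibre+offFibre : ∀ b xs → length xs ≡ length (fibre b xs) + length (offFibre b xs)
  length-fibre+offFibre b []       = refl
  length-fibre+offFibre b (x ∷ xs) with f x ≟ b
  ... | yes _ = cong suc (length-fibre+offFibre b xs)
  ... | no  _ = trans (cong suc (length-fibre+offFibre b xs)) (sym (+-suc _ _))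

  length-fibre-offFibre≤ : ∀ b b′ xs → length (fibre b′ (offFibre b xs)) ≤ length (fibre b′ xs)
  length-fibre-offFibre≤ b b′ xs =
    length-mono-≤ (Sublist.filter⁺ _ _ (λ { refl fx≡b′ → fx≡b′ }) (filter-⊆ _ xs))

  length≤length*maxFibre : ∀ c (T : List B) (xs : List X) → (∀ {x} → x ∈ xs → f x ∈ T) →
                           (∀ b → length (fibre b xs) ≤ c) → length xs ≤ length T * c
  length≤length*maxFibre c [] []       _    _      = z≤n
  length≤length*maxFibre c [] (x ∷ xs) f∈T _      with f∈T (here refl)
  ... | ()
  length≤length*maxFibre c (b ∷ T) xs  f∈T fibre≤ = begin
    length xs                                        ≡⟨ length-fibre+offFibre b xs ⟩
    length (fibre b xs) + length (offFibre b xs)     ≤⟨ +-mono-≤ (fibre≤ b) (length≤length*maxFibre c T (offFibre b xs) off∈T off≤) ⟩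
    c + length T * c                                 ∎
    where
    open ≤-Reasoning
    off∈T : ∀ {x} → x ∈ offFibre b xs → f x ∈ T
    off∈T x∈off with ∈-filter⁻ (λ x → ¬? (f x ≟ b)) x∈off
    ... | x∈xs , fx≢b with f∈T x∈xs
    ...   | here fx≡b = contradiction fx≡b fx≢b
    ...   | there fx∈T = fx∈T
    off≤ : ∀ b′ → length (fibre b′ (offFibre b xs)) ≤ c
    off≤ b′ = ≤-trans (length-fibre-offFibre≤ b b′ xs) (fibre≤ b′)

-- The embedding may depend on the membership proof, as it is obtained by choosing witnesses.
record _↪_ {Q Q′ : Pos} (S : SubPos Q) (S′ : SubPos Q′) : Set where
  field
    image      : ∀ {x} → x ∈ elems S → Carrier Q′
    image-∈    : ∀ {x} (p : x ∈ elems S) → image p ∈ elems S′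
    injective  : ∀ {x y} (p : x ∈ elems S) (q : y ∈ elems S) → image p ≡ image q → x ≡ y
    strictMono : ∀ {x y} (p : x ∈ elems S) (q : y ∈ elems S) →
                 Pos._≤_ Q x y → x ≢ y → Pos._≤_ Q′ (image p) (image q)
    reflects   : ∀ {x y} (p : x ∈ elems S) (q : y ∈ elems S) →
                 Pos._≤_ Q′ (image p) (image q) → Pos._≤_ Q x y

module _ {Q Q′ : Pos} (_≟_ : DecidableEquality (Carrier Q)) {S : SubPos Q} {S′ : SubPos Q′}
         (S↪S′ : S ↪ S′) where
  open _↪_ S↪S′

  Contains-↪ : ∀ {R} → Contains S R → Contains S′ R
  Contains-↪ {R} (g , g-injective , g∈S , g-embedding) =
    (λ x → image (g∈S x)) , (λ eq → g-injective (injective _ _ eq)) , (λ x → image-∈ (g∈S x)) ,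
    λ x y → monotone x y , proj₂ (g-embedding x y) ∘ reflects _ _
    where
    -- Deciding g x ≟ g y is what lets us reuse one membership proof when g x ≡ g y.
    monotone : ∀ x y → Pos._≤_ R x y → Pos._≤_ Q′ (image (g∈S x)) (image (g∈S y))
    monotone x y x≤y with g x ≟ g y
    ... | yes gx≡gy with g-injective gx≡gy
    ...   | refl = Pos.refl Q′
    monotone x y x≤y | no gx≢gy = strictMono _ _ (proj₁ (g-embedding x y) x≤y) gx≢gy

  Free-↪ : ∀ {𝓕} → Free 𝓕 S′ → Free 𝓕 S
  Free-↪ S′-free R R∈𝓕 = S′-free R R∈𝓕 ∘ Contains-↪ {R}

module LexPower (P : Pos) (_≟_ : DecidableEquality (Carrier P)) where
  open Pos P using () renaming (Carrier to A; _≤_ to _≤P_)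
  open Lex P
  open module HeadFibres {k : ℕ} = Fibres {Vec A (suc k)} _≟_ head

  ∷-monoʳ-≤L : ∀ {k a} {u v : Vec A k} → u ≤L v → (a ∷ u) ≤L (a ∷ v)
  ∷-monoʳ-≤L (inj₁ refl) = inj₁ refl
  ∷-monoʳ-≤L (inj₂ u<v)  = inj₂ (there u<v)

  ∷-cancelˡ-≤L : ∀ {k a} {u v : Vec A k} → (a ∷ u) ≤L (a ∷ v) → u ≤L v
  ∷-cancelˡ-≤L (inj₁ eq)                = inj₁ (∷-injectiveʳ eq)
  ∷-cancelˡ-≤L (inj₂ (here (_ , a≢a))) = contradiction refl a≢a
  ∷-cancelˡ-≤L (inj₂ (there u<v))       = inj₂ u<v

  head-mono-≤L : ∀ {k} {u v : Vec A (suc k)} → u ≤L v → head u ≤P head v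
  head-mono-≤L (inj₁ refl)             = Pos.refl P
  head-mono-≤L (inj₂ (here (a≤b , _))) = a≤b
  head-mono-≤L (inj₂ (there _))        = Pos.refl P

  head-<⇒≤L : ∀ {k} {u v : Vec A (suc k)} → head u ≤P head v → head u ≢ head v → u ≤L v
  head-<⇒≤L {u = _ ∷ _} {_ ∷ _} a≤b a≢b = inj₂ (here (a≤b , a≢b))

  cons-tail-fibre : ∀ {k} a (xs : List (Vec A (suc k))) → map (a ∷_) (map tail (fibre a xs)) ≡ fibre a xs
  cons-tail-fibre a []             = refl
  cons-tail-fibre a ((b ∷ v) ∷ xs) with b ≟ a
  ... | yes refl = cong ((a ∷ v) ∷_) (cons-tail-fibre a xs)
  ... | no  _    = cons-tail-fibre a xs

  fibreSub : ∀ {k} → A → SubPos (P ^ₚ suc k) → SubPos (P ^ₚ k)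
  fibreSub a S = record
    { elems  = map tail (fibre a (elems S))
    ; unique = Unique.map⁻ (subst Unique (sym (cons-tail-fibre a (elems S))) (Unique.filter⁺ (λ x → head x ≟ a) (unique S)))
    }

  fibreSub-∈ : ∀ {k a} (S : SubPos (P ^ₚ suc k)) {v} → v ∈ elems (fibreSub a S) → (a ∷ v) ∈ elems S
  fibreSub-∈ {a = a} S {v} v∈ =
    proj₁ (∈-filter⁻ (λ x → head x ≟ a) (subst ((a ∷ v) ∈_) (cons-tail-fibre a (elems S)) (∈-map⁺ (a ∷_) v∈)))

  fibre↪ : ∀ {k} a (S : SubPos (P ^ₚ suc k)) → fibreSub a S ↪ S
  fibre↪ a S = record
    { image      = λ {v} _ → a ∷ v
    ; image-∈    = fibreSub-∈ S
    ; injective  = λ _ _ → ∷-injectiveʳ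
    ; strictMono = λ _ _ u≤v _ → ∷-monoʳ-≤L u≤v
    ; reflects   = λ _ _ → ∷-cancelˡ-≤L
    }

  headsSub : ∀ {k} → SubPos (P ^ₚ suc k) → SubPos P
  headsSub S = record { elems = deduplicate _≟_ (map head (elems S)) ; unique = deduplicate-! _≟_ _ }

  head-∈-headsSub : ∀ {k} (S : SubPos (P ^ₚ suc k)) {v} → v ∈ elems S → head v ∈ elems (headsSub S)
  head-∈-headsSub S = ∈-deduplicate⁺ _≟_ ∘ ∈-map⁺ head

  headsSub-witness : ∀ {k} (S : SubPos (P ^ₚ suc k)) {a} → a ∈ elems (headsSub S) →
                     ∃ λ v → v ∈ elems S × a ≡ head v
  headsSub-witness S = ∈-map⁻ head ∘ ∈-deduplicate⁻ _≟_ _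

  heads↪ : ∀ {k} (S : SubPos (P ^ₚ suc k)) → headsSub S ↪ S
  heads↪ S = record
    { image      = proj₁ ∘ witness
    ; image-∈    = proj₁ ∘ proj₂ ∘ witness
    ; injective  = λ p q eq → trans (hd p) (trans (cong head eq) (sym (hd q)))
    ; strictMono = λ p q a≤b a≢b →
        head-<⇒≤L (subst₂ _≤P_ (hd p) (hd q) a≤b) (λ eq → a≢b (trans (hd p) (trans eq (sym (hd q)))))
    ; reflects   = λ p q v≤w → subst₂ _≤P_ (sym (hd p)) (sym (hd q)) (head-mono-≤L v≤w)
    }
    where
    witness = headsSub-witness S
    hd : ∀ {a} (p : a ∈ elems (headsSub S)) → a ≡ head (proj₁ (witness p))
    hd = proj₂ ∘ proj₂ ∘ witness

  size-free-^ : ∀ {𝓕 e} → (∀ (S : SubPos P) → Free 𝓕 S → size S ≤ e) →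
                ∀ k (S : SubPos (P ^ₚ k)) → Free 𝓕 S → size S ≤ e ^ k
  size-free-^ bound zero    S _      = length≤1-Unique (λ { [] [] → refl }) (unique S)
  size-free-^ {e = e} bound (suc k) S S-free = begin
    size S                        ≤⟨ length≤length*maxFibre (e ^ k) _ (elems S) (head-∈-headsSub S) fibre≤ ⟩
    size (headsSub S) * e ^ k     ≤⟨ *-monoˡ-≤ (e ^ k) (bound (headsSub S) (Free-↪ _≟_ (heads↪ S) S-free)) ⟩
    e * e ^ k                     ∎
    where
    open ≤-Reasoning
    fibre≤ : ∀ a → length (fibre a (elems S)) ≤ e ^ k
    fibre≤ a = ≤-trans (≤-reflexive (sym (length-map tail (fibre a (elems S)))))
                       (size-free-^ bound k (fibreSub a S) (Free-↪ (≡-dec _≟_) (fibre↪ {k} a S) S-free))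

theorem1 : (P : Pos) (m : ℕ) → HasSize P m → 2 ≤ m →
    (𝓕 : Family) (k : ℕ) → 1 ≤ k →
    (e e′ e″ : ℕ) →
    IsExStar P 𝓕 e → IsExStar (P ^ₚ k) 𝓕 e′ → IsExStarN (m ^ k) 𝓕 e″ →
    e″ ≤ e′ × e′ ≤ e ^ k
theorem1 P m P↔m _ 𝓕 k _ e e′ e″ (_ , P-max) P^k-ex@((S , S-free , size≡e′) , _) (_ , n-min) =
  n-min (P ^ₚ k) (Vec↔Fin^ P↔m k) e′ P^k-ex ,
  subst (_≤ e ^ k) size≡e′ (LexPower.size-free-^ P _≟_ P-max k S S-free)
  where
  _≟_ : DecidableEquality (Carrier P)
  _≟_ = via-injection (↔⇒↣ P↔m) Fin._≟_
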